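{- Let $a,b,c\in\mathbb{Z}$ with $a\equiv 2\pmod 4$, $b$ odd, and $ab(a+b)c$ a perfect square. Then the equation $ax^2+by^2=cz^2$ is not partition regular with respect to $x,y$: there is a finite coloring of $\mathbb{N}$ such that there are no distinct $x,y\in\mathbb{N}$ of the same color and $z\in\mathbb{N}$ with $ax^2+by^2=cz^2$. -}

module Defs where

open import Data.Nat using (ℕ; suc)
open import Data.Fin using (Fin)
open import Data.Integer using (ℤ; +_; _+_; _*_)
open import Data.Product using (Σ; ∃; _×_)
open import Relation.Binary.PropositionalEquality using (_≡_; _≢_)
open import Relation.Nullary using (¬_)

Cong2Mod4 : ℤ → Set
Cong2Mod4 a = ∃ λ (k : ℤ) → a ≡ + 4 * k + + 2

OddInt : ℤ → Set
OddInt b = ∃ λ (k : ℤ) → b ≡ + 2 * k + + 1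

IsSquare : ℤ → Set
IsSquare n = ∃ λ (m : ℤ) → n ≡ m * m

-- The paper's ℕ = {1,2,3,...}; we represent n ∈ ℕ by  suc n  (n : Data.Nat.ℕ).
-- Integer value of the positive natural represented by n.
pos : ℕ → ℤ
pos n = + suc n

NoMonoSolution : ℤ → ℤ → ℤ → (r : ℕ) → (ℕ → Fin r) → Set
NoMonoSolution a b c r χ =
  ∀ (x y z : ℕ) → x ≢ y → χ x ≡ χ y →
    a * (pos x * pos x) + b * (pos y * pos y) ≢ c * (pos z * pos z)

NotPartitionRegularXY : ℤ → ℤ → ℤ → Set
NotPartitionRegularXY a b c = ∃ λ (r : ℕ) → Σ (ℕ → Fin r) λ χ → NoMonoSolution a b c r χ

-- Colour n by the parity of v₂(n). If a x² + b y² = c z² and ab(a+b)c = m², then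
-- N = ab(a+b)(a x² + b y²) = (m z)² is a square. But N is not a square when v₂(y) ≠ v₂(x) + 1,
-- in particular when x and y have the same colour: halving x and y divides N by 4, so we may
-- assume x or y odd. Writing a = 2α with α and b odd, N ≡ 2 (mod 4) if y is odd, and N = 4M
-- with M ≡ 3 (mod 4) if x is odd and 4 ∣ y; squares are ≡ 0 or 1 (mod 4).
module Submission where

open import Defs
open import Data.Fin using (Fin; toℕ)
open import Data.Fin.Properties using (toℕ-fromℕ<)
open import Data.Integer using (ℤ; +_; 0ℤ; 1ℤ; _+_; _-_; _*_; -_; NonZero)
open import Data.Integer.DivMod using (_%_; _/_; a≡a%n+[a/n]*n; n%d<d)
open import Data.Integer.Divisibility.Signed
  using (_∣_; divides; _∣?_; ∣-refl; ∣m∣n⇒∣m+n; ∣m⇒∣-m; ∣n⇒∣m*n; ∣m⇒∣m*n; *-monoʳ-∣)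
open import Data.Integer.Properties using (+-identityʳ; +-inverseʳ; *-cancelˡ-≡; *-assoc; pos-*)
open import Data.Integer.Tactic.RingSolver using (solve-∀)
open import Data.Nat using (ℕ; zero; suc; s≤s)
import Data.Nat as ℕ
open import Data.Nat.DivMod as ℕ using (m%n<n; m≡m%n+[m/n]*n)
open import Data.Nat.Induction using (<-rec)
open import Data.Nat.Properties using (m≤m*n)
open import Data.Product using (∃; _×_; _,_; proj₁; proj₂)
open import Data.Sum using (_⊎_; inj₁; inj₂)
open import Function using (_∘_; case_of_)
open import Relation.Binary.PropositionalEquality
  using (_≡_; _≢_; refl; sym; trans; subst; cong; module ≡-Reasoning)
open import Relation.Nullary using (¬_; Dec; contradiction; contradiction₂)
open import Relation.Nullary.Decidable using (map′; from-no)

-- A record rather than a synonym for n ∣ x - y, so that x, y and n can be inferred.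
record _≡_mod_ (x y n : ℤ) : Set where
  constructor congruent
  field ∣-difference : n ∣ x - y

infix 4 _≡_mod_ _≡?_mod_

open _≡_mod_ using (∣-difference)

_≡?_mod_ : ∀ x y n → Dec (x ≡ y mod n)
x ≡? y mod n = map′ congruent ∣-difference (n ∣? x - y)

module _ {n : ℤ} where

  mod-refl : ∀ {x} → x ≡ x mod n
  mod-refl {x} = congruent (divides 0ℤ (+-inverseʳ x))

  mod-sym : ∀ {x y} → x ≡ y mod n → y ≡ x mod n
  mod-sym {x} {y} (congruent p) = congruent (subst (n ∣_) (negate x y) (∣m⇒∣-m p))
    where
    negate : ∀ x y → - (x - y) ≡ y - x
    negate = solve-∀

  mod-trans : ∀ {x y z} → x ≡ y mod n → y ≡ z mod n → x ≡ z mod n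
  mod-trans {x} {y} {z} (congruent p) (congruent q) =
    congruent (subst (n ∣_) (telescope x y z) (∣m∣n⇒∣m+n p q))
    where
    telescope : ∀ x y z → (x - y) + (y - z) ≡ x - z
    telescope = solve-∀

  mod-+ : ∀ {x y u v} → x ≡ y mod n → u ≡ v mod n → x + u ≡ y + v mod n
  mod-+ {x} {y} {u} {v} (congruent p) (congruent q) =
    congruent (subst (n ∣_) (regroup x y u v) (∣m∣n⇒∣m+n p q))
    where
    regroup : ∀ x y u v → (x - y) + (u - v) ≡ (x + u) - (y + v)
    regroup = solve-∀

  mod-* : ∀ {x y u v} → x ≡ y mod n → u ≡ v mod n → x * u ≡ y * v mod n
  mod-* {x} {y} {u} {v} (congruent p) (congruent q) =
    congruent (subst (n ∣_) (regroup x y u v) (∣m∣n⇒∣m+n (∣n⇒∣m*n x q) (∣m⇒∣m*n v p)))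
    where
    regroup : ∀ x y u v → x * (u - v) + (x - y) * v ≡ x * u - y * v
    regroup = solve-∀

  mod-scale : ∀ k {x y} → x ≡ y mod n → k * x ≡ k * y mod k * n
  mod-scale k {x} {y} (congruent p) = congruent (subst (k * n ∣_) (distrib k x y) (*-monoʳ-∣ k p))
    where
    distrib : ∀ k x y → k * (x - y) ≡ k * x - k * y
    distrib = solve-∀

  n*k≡0-mod-n : ∀ k → n * k ≡ 0ℤ mod n
  n*k≡0-mod-n k = congruent (subst (n ∣_) (sym (+-identityʳ (n * k))) (∣m⇒∣m*n k ∣-refl))

m≡m%n-mod-n : ∀ m n .{{_ : NonZero n}} → m ≡ + (m % n) mod n
m≡m%n-mod-n m n = congruent (divides (m / n) (begin
  m - r                ≡⟨ cong (_- r) (a≡a%n+[a/n]*n m n) ⟩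
  (r + m / n * n) - r  ≡⟨ cancel r (m / n * n) ⟩
  m / n * n            ∎))
  where
  open ≡-Reasoning
  r = + (m % n)
  cancel : ∀ r t → (r + t) - r ≡ t
  cancel = solve-∀

even-or-odd : ∀ m → m ≡ 0ℤ mod + 2 ⊎ m ≡ 1ℤ mod + 2
even-or-odd m with m % + 2 | n%d<d m (+ 2) | m≡m%n-mod-n m (+ 2)
... | 0           | _            | m≡0 = inj₁ m≡0
... | 1           | _            | m≡1 = inj₂ m≡1
... | suc (suc _) | s≤s (s≤s ()) | _

mod-2⇒square-mod-4 : ∀ {x y} → x ≡ y mod + 2 → x * x ≡ y * y mod + 4
mod-2⇒square-mod-4 {x} {y} (congruent (divides q x-y≡2q)) = congruent (divides (q * q + q * y) (begin
  x * x - y * y                  ≡⟨ factor x y ⟩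
  (x - y) * ((x - y) + + 2 * y)  ≡⟨ cong (λ d → d * (d + + 2 * y)) x-y≡2q ⟩
  q * + 2 * (q * + 2 + + 2 * y)  ≡⟨ expand q y ⟩
  (q * q + q * y) * + 4          ∎))
  where
  open ≡-Reasoning
  factor : ∀ x y → x * x - y * y ≡ (x - y) * ((x - y) + + 2 * y)
  factor = solve-∀
  expand : ∀ q y → q * + 2 * (q * + 2 + + 2 * y) ≡ (q * q + q * y) * + 4
  expand = solve-∀

square-mod-4 : ∀ m → m * m ≡ 0ℤ mod + 4 ⊎ m * m ≡ 1ℤ mod + 4
square-mod-4 m with even-or-odd m
... | inj₁ m≡0 = inj₁ (mod-2⇒square-mod-4 m≡0)
... | inj₂ m≡1 = inj₂ (mod-2⇒square-mod-4 m≡1)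

¬square-mod-4 : ∀ {n r} → n ≡ r mod + 4 → ¬ (r ≡ 0ℤ mod + 4) → ¬ (r ≡ 1ℤ mod + 4) → ¬ IsSquare n
¬square-mod-4 n≡r r≢0 r≢1 (m , refl) =
  contradiction₂ (square-mod-4 m) (r≢0 ∘ mod-trans (mod-sym n≡r)) (r≢1 ∘ mod-trans (mod-sym n≡r))

square-4*⇒square : ∀ {K} → IsSquare (+ 4 * K) → IsSquare K
square-4*⇒square {K} (m , 4K≡m²) with even-or-odd m
... | inj₂ m≡1 =
  contradiction (mod-trans (mod-sym (mod-2⇒square-mod-4 m≡1)) m²≡0) (from-no (1ℤ ≡? 0ℤ mod + 4))
  where
  m²≡0 : m * m ≡ 0ℤ mod + 4
  m²≡0 = subst (_≡ 0ℤ mod + 4) 4K≡m² (n*k≡0-mod-n K)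
... | inj₁ (congruent (divides h m-0≡h2)) = h , *-cancelˡ-≡ (+ 4) K (h * h) (begin
  + 4 * K              ≡⟨ 4K≡m² ⟩
  m * m                ≡⟨ cong (λ t → t * t) m≡h2 ⟩
  h * + 2 * (h * + 2)  ≡⟨ regroup h ⟩
  + 4 * (h * h)        ∎)
  where
  open ≡-Reasoning
  m≡h2 : m ≡ h * + 2
  m≡h2 = trans (sym (+-identityʳ m)) m-0≡h2
  regroup : ∀ h → h * + 2 * (h * + 2) ≡ + 4 * (h * h)
  regroup = solve-∀

¬square-2-mod-4 : ∀ {n} → n ≡ + 2 mod + 4 → ¬ IsSquare n
¬square-2-mod-4 n≡2 = ¬square-mod-4 n≡2 (from-no (+ 2 ≡? 0ℤ mod + 4)) (from-no (+ 2 ≡? 1ℤ mod + 4))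

¬square-4*3-mod-4 : ∀ {M} → M ≡ + 3 mod + 4 → ¬ IsSquare (+ 4 * M)
¬square-4*3-mod-4 M≡3 =
  ¬square-mod-4 M≡3 (from-no (+ 3 ≡? 0ℤ mod + 4)) (from-no (+ 3 ≡? 1ℤ mod + 4)) ∘ square-4*⇒square

scaledForm : ℤ → ℤ → ℤ → ℤ → ℤ
scaledForm a b X Y = a * b * (a + b) * (a * (X * X) + b * (Y * Y))

scaledForm-double : ∀ a b X Y → scaledForm a b (+ 2 * X) (+ 2 * Y) ≡ + 4 * scaledForm a b X Y
scaledForm-double = expand
  where
  expand : ∀ a b X Y → a * b * (a + b) * (a * (+ 2 * X * (+ 2 * X)) + b * (+ 2 * Y * (+ 2 * Y)))
                       ≡ + 4 * (a * b * (a + b) * (a * (X * X) + b * (Y * Y)))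
  expand = solve-∀

data Valuation₂ : ℕ → ℤ → Set where
  odd    : ∀ {X} → X ≡ 1ℤ mod + 2 → Valuation₂ zero X
  double : ∀ {i X} → Valuation₂ i X → Valuation₂ (suc i) (+ 2 * X)

module _ {α b : ℤ} (α-odd : α ≡ 1ℤ mod + 2) (b-odd : b ≡ 1ℤ mod + 2) where

  scaledForm-odd-right : ∀ {X Y} → Y ≡ 1ℤ mod + 2 → scaledForm (+ 2 * α) b X Y ≡ + 2 mod + 4
  scaledForm-odd-right {X} {Y} Y-odd =
    subst (_≡ + 2 mod + 4) (sym (factor α b X Y)) (mod-scale (+ 2) cofactor-odd)
    where
    factor : ∀ α b X Y → + 2 * α * b * (+ 2 * α + b) * (+ 2 * α * (X * X) + b * (Y * Y))
                         ≡ + 2 * (α * b * (+ 2 * α + b) * (+ 2 * α * (X * X) + b * (Y * Y)))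
    factor = solve-∀
    cofactor-odd : α * b * (+ 2 * α + b) * (+ 2 * α * (X * X) + b * (Y * Y)) ≡ 1ℤ mod + 2
    cofactor-odd = mod-* (mod-* (mod-* α-odd b-odd) (mod-+ (n*k≡0-mod-n α) b-odd))
                         (mod-+ (mod-* (n*k≡0-mod-n α) mod-refl) (mod-* b-odd (mod-* Y-odd Y-odd)))

  -- M is grouped so that mod 4 it reads (2 + 1) * (1 + 0), as 2αb ≡ 2 and b² ≡ (αX)² ≡ 1.
  scaledForm-odd-left : ∀ {X W} → X ≡ 1ℤ mod + 2 →
    ∃ λ M → M ≡ + 3 mod + 4 × scaledForm (+ 2 * α) b X (+ 2 * (+ 2 * W)) ≡ + 4 * M
  scaledForm-odd-left {X} {W} X-odd =
    (+ 2 * (α * b) + b * b) * (α * X * (α * X) + + 4 * (+ 2 * α * b * (W * W))) ,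
    mod-* (mod-+ (mod-scale (+ 2) (mod-* α-odd b-odd)) (mod-2⇒square-mod-4 b-odd))
          (mod-+ (mod-2⇒square-mod-4 (mod-* α-odd X-odd)) (n*k≡0-mod-n _)) ,
    factor α b X W
    where
    factor : ∀ α b X W → + 2 * α * b * (+ 2 * α + b)
                         * (+ 2 * α * (X * X) + b * (+ 2 * (+ 2 * W) * (+ 2 * (+ 2 * W))))
             ≡ + 4 * ((+ 2 * (α * b) + b * b) * (α * X * (α * X) + + 4 * (+ 2 * α * b * (W * W))))
    factor = solve-∀

  scaledForm-¬square : ∀ {i j X Y} → Valuation₂ i X → Valuation₂ j Y → j ≢ suc i →
                       ¬ IsSquare (scaledForm (+ 2 * α) b X Y)
  scaledForm-¬square {X = X} _ (odd Y-odd) _ = ¬square-2-mod-4 (scaledForm-odd-right {X} Y-odd)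
  scaledForm-¬square (odd _) (double (odd _)) 1≢1 = contradiction refl 1≢1
  scaledForm-¬square (odd {X} X-odd) (double (double {X = W} _)) _ =
    case scaledForm-odd-left {X} {W} X-odd of λ where
      (M , M≡3 , form≡4M) → ¬square-4*3-mod-4 M≡3 ∘ subst IsSquare form≡4M
  scaledForm-¬square (double {X = X} vX) (double {X = Y} vY) j≢i+1 =
    scaledForm-¬square vX vY (j≢i+1 ∘ cong suc)
      ∘ square-4*⇒square ∘ subst IsSquare (scaledForm-double (+ 2 * α) b X Y)

valuation₂ : ∀ n → ∃ λ i → Valuation₂ i (+ suc n)
valuation₂ = <-rec (λ n → ∃ λ i → Valuation₂ i (+ suc n)) step
  where
  open ≡-Reasoning
  step : ∀ n → (∀ {m} → m ℕ.< n → ∃ λ i → Valuation₂ i (+ suc m)) → ∃ λ i → Valuation₂ i (+ suc n)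
  step n rec with n ℕ.% 2 | m%n<n n 2 | m≡m%n+[m/n]*n n 2
  ... | 0 | _ | n≡2q = 0 , odd (congruent (divides (+ q) (begin
    + suc n - 1ℤ  ≡⟨ cancel (+ n) ⟩
    + n           ≡⟨ cong +_ n≡2q ⟩
    + (q ℕ.* 2)   ≡⟨ pos-* q 2 ⟩
    + q * + 2     ∎)))
    where
    q = n ℕ./ 2
    cancel : ∀ x → (1ℤ + x) - 1ℤ ≡ x
    cancel = solve-∀
  ... | 1 | _ | n≡2q+1 =
    let i , v = rec q<n in suc i , subst (Valuation₂ (suc i)) (sym suc-n≡2[q+1]) (double v)
    where
    q = n ℕ./ 2
    q<n : q ℕ.< n
    q<n = subst (q ℕ.<_) (sym n≡2q+1) (s≤s (m≤m*n q 2))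
    double-suc : ∀ x → + 2 + x * + 2 ≡ + 2 * (1ℤ + x)
    double-suc = solve-∀
    suc-n≡2[q+1] : + suc n ≡ + 2 * + suc q
    suc-n≡2[q+1] = begin
      + suc n            ≡⟨ cong (λ t → + suc t) n≡2q+1 ⟩
      + 2 + + (q ℕ.* 2)  ≡⟨ cong (_+_ (+ 2)) (pos-* q 2) ⟩
      + 2 + + q * + 2    ≡⟨ double-suc (+ q) ⟩
      + 2 * + suc q      ∎
  ... | suc (suc _) | s≤s (s≤s ()) | _

colouring : ℕ → Fin 2
colouring n = proj₁ (valuation₂ n) ℕ.mod 2

-- Typechecks because suc (suc i) % 2 reduces to i % 2.
%2-suc≢ : ∀ i → suc i ℕ.% 2 ≢ i ℕ.% 2
%2-suc≢ zero    ()
%2-suc≢ (suc i) = %2-suc≢ i ∘ sym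

mod-2-≡⇒≢suc : ∀ {i j} → i ℕ.mod 2 ≡ j ℕ.mod 2 → j ≢ suc i
mod-2-≡⇒≢suc {i} i≡j refl = %2-suc≢ i (sym (begin
  i ℕ.% 2              ≡⟨ sym (toℕ-fromℕ< (m%n<n i 2)) ⟩
  toℕ (i ℕ.mod 2)      ≡⟨ cong toℕ i≡j ⟩
  toℕ (suc i ℕ.mod 2)  ≡⟨ toℕ-fromℕ< (m%n<n (suc i) 2) ⟩
  suc i ℕ.% 2          ∎))
  where open ≡-Reasoning

OddInt⇒≡1-mod-2 : ∀ {b} → OddInt b → b ≡ 1ℤ mod + 2
OddInt⇒≡1-mod-2 (k , refl) = congruent (divides k (cancel k))
  where
  cancel : ∀ k → + 2 * k + + 1 - 1ℤ ≡ k * + 2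
  cancel = solve-∀

Cong2Mod4⇒twice-odd : ∀ {a} → Cong2Mod4 a → ∃ λ α → α ≡ 1ℤ mod + 2 × a ≡ + 2 * α
Cong2Mod4⇒twice-odd (k , refl) = + 2 * k + + 1 , OddInt⇒≡1-mod-2 (k , refl) , halve k
  where
  halve : ∀ k → + 4 * k + + 2 ≡ + 2 * (+ 2 * k + + 1)
  halve = solve-∀

proposition1p20 : (a b c : ℤ) → Cong2Mod4 a → OddInt b → IsSquare (a * b * (a + b) * c) →
    NotPartitionRegularXY a b c
proposition1p20 a b c a≡2-mod-4 b-odd (m , abc≡m²)
  with α , α-odd , refl ← Cong2Mod4⇒twice-odd a≡2-mod-4 = 2 , colouring , no-solution
  where
  no-solution : NoMonoSolution (+ 2 * α) b c 2 colouring
  no-solution x y z _ same-colour solution =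
    scaledForm-¬square α-odd (OddInt⇒≡1-mod-2 b-odd) (proj₂ (valuation₂ x)) (proj₂ (valuation₂ y))
      (mod-2-≡⇒≢suc same-colour) (m * Z , form≡[mZ]²)
    where
    open ≡-Reasoning
    A = + 2 * α * b * (+ 2 * α + b)
    Z = pos z
    regroup : ∀ m Z → m * m * (Z * Z) ≡ m * Z * (m * Z)
    regroup = solve-∀
    form≡[mZ]² : scaledForm (+ 2 * α) b (pos x) (pos y) ≡ m * Z * (m * Z)
    form≡[mZ]² = begin
      A * (+ 2 * α * (pos x * pos x) + b * (pos y * pos y))  ≡⟨ cong (A *_) solution ⟩
      A * (c * (Z * Z))                                        ≡⟨ sym (*-assoc A c (Z * Z)) ⟩
      A * c * (Z * Z)                                          ≡⟨ cong (_* (Z * Z)) abc≡m² ⟩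
      m * m * (Z * Z)                                          ≡⟨ regroup m Z ⟩
      m * Z * (m * Z)                                          ∎
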